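{- A (non-oriented) graph is a Burling graph if and only if it is a derived graph. That is, a graph $H$ is isomorphic to an induced subgraph of some graph $G_k$ of the Burling sequence if and only if $H$ is isomorphic to the underlying graph of an induced subgraph of the oriented graph fully derived from some Burling tree.
   Context: Trees: in a rooted tree with root $r$, every vertex $v\neq r$ has a parent $p(v)$ (its neighbour on the path to $r$); a branch is a path $v_1v_2\dots v_k$ with $v_i$ the parent of $v_{i+1}$ for all $i<k$ (it starts at $v_1$). A Burling tree is a 4-tuple $(T,r,\lambda,c)$ where $T$ is a rooted tree with root $r$; $\lambda$ assigns to each non-leaf vertex $v$ one of its children, called the last-born of $v$; and $c$ is a function on $V(T)$ such that if $v\neq r$ is not a last-born then $c(v)$ is the vertex set of a (possibly empty) branch of $T$ starting at the last-born of $p(v)$, while $c(v)=\varnothing$ if $v$ is a last-born or the root. The oriented graph fully derived from $(T,r,\lambda,c)$ has vertex set $V(T)$ and an arc $uv$ iff $v\in c(u)$. An oriented graph is derived from a Burling tree if it is an induced subgraph of the oriented graph fully derived from it; a non-oriented graph is a derived graph if it is the underlying graph of such an oriented graph, for some Burling tree. Burling sequence: for a graph $G$ and a set $\mathcal S$ of stable sets of $G$, define $\mathrm{next}(G,\mathcal S)=(G',\mathcal S')$ as follows. $G'$ consists of a copy of $G$; for each $S\in\mathcal S$ a new disjoint copy $G_S$ of $G$, in which $\mathcal S_S$ denotes the copy of $\mathcal S$; and for each $S\in\mathcal S$ and $Q\in\mathcal S_S$ a new vertex $v_{S,Q}$ adjacent exactly to the vertices of $Q$. $\mathcal S'$ is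 the set of all stable sets $S\cup Q$ and $S\cup\{v_{S,Q}\}$ for $S\in\mathcal S$ (in the first copy of $G$) and $Q\in\mathcal S_S$. Start with $G_1=K_1$, $\mathcal S_1=\{V(G_1)\}$ and set $(G_{k+1},\mathcal S_{k+1})=\mathrm{next}(G_k,\mathcal S_k)$. A Burling graph is a graph isomorphic to an induced subgraph of some $G_k$. -}

module Defs where

open import Data.Nat using (ℕ; zero; suc; _≤_)
open import Data.Fin using (Fin; zero; suc; toℕ)
open import Data.Bool using (Bool; true; false)
open import Data.Unit using (⊤; tt)
open import Data.Empty using (⊥)
open import Data.Maybe using (Maybe; just; nothing)
open import Data.List using (List; []; _∷_)
open import Data.List.Membership.Propositional using (_∈_)
open import Data.Product using (Σ; _×_; _,_; ∃)
open import Data.Sum using (_⊎_; inj₁; inj₂)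
open import Relation.Nullary using (¬_)
open import Relation.Binary.PropositionalEquality using (_≡_)
open import Function.Definitions using (Injective)
open import Function.Bundles using (_⇔_)

record FinGraph : Set where
  field
    n      : ℕ
    E      : Fin n → Fin n → Bool
    sym    : ∀ x y → E x y ≡ E y x
    irrefl : ∀ x → E x x ≡ false

IsoToInduced : (H : FinGraph) (W : Set) (R : W → W → Set) → Set
IsoToInduced H W R =
  Σ (Fin n → W) λ f →
    Injective _≡_ _≡_ f ×
    (∀ x y → (E x y ≡ true) ⇔ R (f x) (f y))
  where open FinGraph H

-- The Burling sequence.  Index k = 0 corresponds to (G_1, S_1).
-- BV k  : vertices of G_{k+1}
-- BI k  : index type of the family S_{k+1} of stable sets
-- Bmem k S v : v belongs to the stable set S
-- BAdj k u v : u and v are adjacent in G_{k+1}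
--
-- next(G,S): vertices are
--   inj₁ v                 : v in the first copy of G
--   inj₂ (inj₁ (S , v))    : the copy of v in G_S
--   inj₂ (inj₂ (S , Q))    : the new vertex v_{S,Q}
-- stable sets (S , Q , true) = S ∪ Q  and  (S , Q , false) = S ∪ {v_{S,Q}}.

BV  : ℕ → Set
BI  : ℕ → Set
BV zero    = ⊤
BV (suc k) = BV k ⊎ ((BI k × BV k) ⊎ (BI k × BI k))
BI zero    = ⊤
BI (suc k) = BI k × BI k × Bool

Bmem : (k : ℕ) → BI k → BV k → Set
Bmem zero    S v = ⊤
Bmem (suc k) (S , Q , true)  (inj₁ v)                 = Bmem k S v
Bmem (suc k) (S , Q , true)  (inj₂ (inj₁ (S' , v)))   = (S' ≡ S) × Bmem k Q v
Bmem (suc k) (S , Q , true)  (inj₂ (inj₂ _))          = ⊥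
Bmem (suc k) (S , Q , false) (inj₁ v)                 = Bmem k S v
Bmem (suc k) (S , Q , false) (inj₂ (inj₁ _))          = ⊥
Bmem (suc k) (S , Q , false) (inj₂ (inj₂ (S' , Q')))  = (S' , Q') ≡ (S , Q)

BAdj : (k : ℕ) → BV k → BV k → Set
BAdj zero    u v = ⊥
BAdj (suc k) (inj₁ u)                (inj₁ v)                = BAdj k u v
BAdj (suc k) (inj₂ (inj₁ (S , u)))   (inj₂ (inj₁ (S' , v)))  = (S ≡ S') × BAdj k u v
BAdj (suc k) (inj₂ (inj₁ (S' , u)))  (inj₂ (inj₂ (S , Q)))   = (S' ≡ S) × Bmem k Q u
BAdj (suc k) (inj₂ (inj₂ (S , Q)))   (inj₂ (inj₁ (S' , u)))  = (S' ≡ S) × Bmem k Q u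
BAdj (suc k) _                       _                       = ⊥

IsBurlingGraph : FinGraph → Set
IsBurlingGraph H = Σ ℕ λ k → IsoToInduced H (BV k) (BAdj k)

-- A finite rooted tree is given on vertex set Fin (suc m) with root zero;
-- the parent of vertex (suc i) is par i, and toℕ (par i) ≤ toℕ i
-- (parents are numbered before their children, which makes the structure
-- a tree rooted at zero; every finite rooted tree has such a numbering).

module TreeDefs {m : ℕ} (par : Fin m → Fin (suc m)) where

  IsParent : Fin (suc m) → Fin (suc m) → Set
  IsParent x zero    = ⊥
  IsParent x (suc i) = par i ≡ x

  data BranchFrom : Fin (suc m) → List (Fin (suc m)) → Set where
    single : ∀ {w} → BranchFrom w (w ∷ [])
    step   : ∀ {w u l} → IsParent w u → BranchFrom u (u ∷ l) →
             BranchFrom w (w ∷ u ∷ l)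

record BurlingTree : Set where
  field
    m      : ℕ
    par    : Fin m → Fin (suc m)
    par≤   : ∀ i → toℕ (par i) ≤ toℕ i
  open TreeDefs par public
  field
    lb       : Fin (suc m) → Maybe (Fin (suc m))
    lb-child : ∀ v u → lb v ≡ just u → IsParent v u
    lb-leaf  : ∀ v → lb v ≡ nothing → ∀ u → ¬ IsParent v u
    c        : Fin (suc m) → List (Fin (suc m))
    c-root   : c zero ≡ []
    c-lastborn : ∀ v u → lb v ≡ just u → c u ≡ []
    c-branch : ∀ i → (¬ ∃ λ v → lb v ≡ just (suc i)) →
               (c (suc i) ≡ []) ⊎
               (Σ (Fin (suc m)) λ w → (lb (par i) ≡ just w) × BranchFrom w (c (suc i)))

  Vertex : Set
  Vertex = Fin (suc m)

  Arc : Vertex → Vertex → Set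
  Arc u v = v ∈ c u

  UAdj : Vertex → Vertex → Set
  UAdj u v = Arc u v ⊎ Arc v u

IsDerivedGraph : FinGraph → Set
IsDerivedGraph H = Σ BurlingTree λ T → IsoToInduced H (BurlingTree.Vertex T) (BurlingTree.UAdj T)

{-# OPTIONS --safe #-}
-- G_k is itself a derived graph.  On its vertices take the Burling tree in which the first copy
-- of G_{k-1} keeps its tree, the copy G_S hangs below the leaf ending the branch formed by the
-- stable set S (its root being the last-born of that leaf), and v_{S,Q} is a further child of
-- that leaf whose arcs go to the branch Q of G_S.  The stable sets in S_k are exactly the
-- root-to-leaf branches, so arcs and edges coincide.
--
-- Conversely, by induction from the leaves up, the subtree at a vertex z embeds into some G_K
-- so that for each x below z some stable set meets the image exactly in the branch from z to x.
-- The vertex z goes to the root, the subtree of the last-born into a copy G_S, every other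
-- child ch to a vertex v_{S,Q} whose neighbours in the image are exactly the branch c(ch), and
-- the subtree below ch into the copy of G attached to the stable set S ∪ {v_{S,Q}}.
module Submission where

open import Defs
open import Data.Nat using (ℕ; zero; suc; _+_; _*_; _≤_; _<_; z≤n; s≤s; _<?_)
open import Data.Nat.Properties
  using (≤-trans; <-≤-trans; ≤-<-trans; ≤-refl; ≤-reflexive; <-irrefl; ≤-pred; n≤1+n;
         m≤m+n; m≤n+m; +-suc; +-monoʳ-≤; +-monoʳ-<)
open import Data.Fin using (Fin; zero; suc; toℕ; _↑ˡ_; _↑ʳ_; combine)
open import Data.Fin.Properties
  using (+↔⊎; *↔×; 1↔⊤; 2↔Bool; toℕ-↑ˡ; toℕ-↑ʳ; toℕ-combine; toℕ<n; toℕ-injective)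
  renaming (_≟_ to _≟ᶠ_)
open import Data.Bool using (true; false)
open import Data.Unit using (tt)
open import Data.Empty using (⊥; ⊥-elim)
open import Data.Maybe using (Maybe; just; nothing; maybe′; fromMaybe)
import Data.Maybe as Maybe
open import Data.Maybe.Properties using (just-injective) renaming (≡-dec to ≡-decᵐ)
open import Data.List using (List; []; _∷_; map; _++_)
open import Data.List.Membership.Propositional using (_∈_)
open import Data.List.Membership.Propositional.Properties
  using (∈-map⁺; ∈-map⁻; ∈-++⁺ˡ; ∈-++⁺ʳ; ∈-++⁻)
open import Data.List.Relation.Unary.Any using (here; there)
open import Data.Product using (Σ; _×_; _,_; ∃; proj₁; proj₂)
open import Data.Product.Function.NonDependent.Propositional using (_×-↔_)
open import Data.Sum using (_⊎_; inj₁; inj₂)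
open import Data.Sum.Properties using (inj₁-injective; inj₂-injective)
open import Data.Sum.Function.Propositional using (_⊎-↔_)
open import Function.Base using (_∘_)
open import Function.Bundles using (_↔_; _⇔_; Inverse; Equivalence; mk⇔)
open import Function.Construct.Composition using (_⇔-∘_)
open import Function.Definitions using (Injective)
open import Function.Properties.Inverse using (↔-trans)
open import Relation.Nullary using (¬_; Dec; yes; no)
open import Relation.Binary.PropositionalEquality
  using (_≡_; _≢_; refl; sym; trans; cong; subst; subst₂)

∈-map-injective : ∀ {A B : Set} {f : A → B} → Injective _≡_ _≡_ f →
                  ∀ {x l} → f x ∈ map f l → x ∈ l
∈-map-injective {f = f} f-inj x∈ with ∈-map⁻ f x∈
... | y , y∈ , e rewrite f-inj e = y∈

∉-map : ∀ {A B : Set} (f : A → B) {z : B} → (∀ y → f y ≢ z) → ∀ {l} → z ∈ map f l → ⊥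
∉-map f f≢z z∈ with ∈-map⁻ f z∈
... | y , _ , e = f≢z y (sym e)

copy : ∀ {k} → BI k → BV k → BV (suc k)
copy S v = inj₂ (inj₁ (S , v))

new : ∀ {k} → BI k → BI k → BV (suc k)
new S Q = inj₂ (inj₂ (S , Q))

copy-injective : ∀ {k} {S S′ : BI k} {x y} → copy S x ≡ copy S′ y → S ≡ S′ × x ≡ y
copy-injective refl = refl , refl

root : ∀ k → BV k
root zero    = tt
root (suc k) = inj₁ (root k)

leaf : ∀ k → BI k → BV k
leaf zero    _               = tt
leaf (suc k) (S , Q , true)  = copy S (leaf k Q)
leaf (suc k) (S , Q , false) = new S Q

leafLabel : ∀ k → BV k → Maybe (BI k)
leafLabel zero    _                     = just tt
leafLabel (suc k) (inj₁ _)              = nothing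
leafLabel (suc k) (inj₂ (inj₁ (S , v))) = Maybe.map (λ Q → S , Q , true) (leafLabel k v)
leafLabel (suc k) (inj₂ (inj₂ (S , Q))) = just (S , Q , false)

parent : ∀ k → BV k → Maybe (BV k)
parent zero    _                     = nothing
parent (suc k) (inj₁ v)              = Maybe.map inj₁ (parent k v)
parent (suc k) (inj₂ (inj₁ (S , v))) = just (maybe′ (copy S) (inj₁ (leaf k S)) (parent k v))
parent (suc k) (inj₂ (inj₂ (S , Q))) = just (inj₁ (leaf k S))

lastBorn : ∀ k → BV k → Maybe (BV k)
lastBorn zero    _                     = nothing
lastBorn (suc k) (inj₁ v)              =
  maybe′ (λ S → just (copy S (root k))) (Maybe.map inj₁ (lastBorn k v)) (leafLabel k v)
lastBorn (suc k) (inj₂ (inj₁ (S , v))) = Maybe.map (copy S) (lastBorn k v)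
lastBorn (suc k) (inj₂ (inj₂ _))       = nothing

branch : ∀ k → BI k → List (BV k)
branch zero    _               = tt ∷ []
branch (suc k) (S , Q , true)  = map inj₁ (branch k S) ++ map (copy S) (branch k Q)
branch (suc k) (S , Q , false) = map inj₁ (branch k S) ++ new S Q ∷ []

arcs : ∀ k → BV k → List (BV k)
arcs zero    _                     = []
arcs (suc k) (inj₁ v)              = map inj₁ (arcs k v)
arcs (suc k) (inj₂ (inj₁ (S , v))) = map (copy S) (arcs k v)
arcs (suc k) (inj₂ (inj₂ (S , Q))) = map (copy S) (branch k Q)

data Branch (k : ℕ) : BV k → BV k → List (BV k) → Set where
  [_] : ∀ a → Branch k a a (a ∷ [])
  _◅_ : ∀ {a u b l} → parent k u ≡ just a → Branch k u b l → Branch k a b (a ∷ l)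

infixr 5 _◅_

parent-root : ∀ k → parent k (root k) ≡ nothing
parent-root zero    = refl
parent-root (suc k) rewrite parent-root k = refl

arcs-root : ∀ k → arcs k (root k) ≡ []
arcs-root zero    = refl
arcs-root (suc k) rewrite arcs-root k = refl

leafLabel-leaf : ∀ k S → leafLabel k (leaf k S) ≡ just S
leafLabel-leaf zero    _               = refl
leafLabel-leaf (suc k) (S , Q , true)  rewrite leafLabel-leaf k Q = refl
leafLabel-leaf (suc k) (S , Q , false) = refl

leaf-leafLabel : ∀ k v {S} → leafLabel k v ≡ just S → leaf k S ≡ v
leaf-leafLabel zero    _                     refl = refl
leaf-leafLabel (suc k) (inj₂ (inj₁ (S , v))) eq with leafLabel k v in e
leaf-leafLabel (suc k) (inj₂ (inj₁ (S , v))) refl | just Q = cong (copy S) (leaf-leafLabel k v e)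
leaf-leafLabel (suc k) (inj₂ (inj₂ _))       refl = refl

parent≡nothing⇒root : ∀ k v → parent k v ≡ nothing → v ≡ root k
parent≡nothing⇒root zero    _ _ = refl
parent≡nothing⇒root (suc k) (inj₁ v) eq with parent k v in e
... | nothing = cong inj₁ (parent≡nothing⇒root k v e)
parent≡nothing⇒root (suc k) (inj₂ (inj₁ _)) ()
parent≡nothing⇒root (suc k) (inj₂ (inj₂ _)) ()

parent⇒not-leaf : ∀ k u {p} → parent k u ≡ just p → leafLabel k p ≡ nothing
parent⇒not-leaf (suc k) (inj₁ u) eq with parent k u
parent⇒not-leaf (suc k) (inj₁ u) refl | just q = refl
parent⇒not-leaf (suc k) (inj₂ (inj₁ (S , u))) eq with parent k u in e
parent⇒not-leaf (suc k) (inj₂ (inj₁ (S , u))) refl | just q rewrite parent⇒not-leaf k u e = refl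
parent⇒not-leaf (suc k) (inj₂ (inj₁ (S , u))) refl | nothing = refl
parent⇒not-leaf (suc k) (inj₂ (inj₂ _)) refl = refl

parent⇒lastBorn : ∀ k u {p} → parent k u ≡ just p → ∃ λ w → lastBorn k p ≡ just w
parent⇒lastBorn (suc k) (inj₁ u) eq with parent k u in e
parent⇒lastBorn (suc k) (inj₁ u) refl | just q with leafLabel k q | parent⇒lastBorn k u e
... | just S  | _      = _ , refl
... | nothing | _ , e′ rewrite e′ = _ , refl
parent⇒lastBorn (suc k) (inj₂ (inj₁ (S , u))) eq with parent k u in e
parent⇒lastBorn (suc k) (inj₂ (inj₁ (S , u))) refl | just q with parent⇒lastBorn k u e
... | _ , e′ rewrite e′ = _ , refl
parent⇒lastBorn (suc k) (inj₂ (inj₁ (S , u))) refl | nothing rewrite leafLabel-leaf k S = _ , refl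
parent⇒lastBorn (suc k) (inj₂ (inj₂ (S , Q))) refl rewrite leafLabel-leaf k S = _ , refl

lastBorn⇒parent : ∀ k p {u} → lastBorn k p ≡ just u → parent k u ≡ just p
lastBorn⇒parent (suc k) (inj₁ p) eq with leafLabel k p in e
lastBorn⇒parent (suc k) (inj₁ p) refl | just S rewrite parent-root k | leaf-leafLabel k p e = refl
lastBorn⇒parent (suc k) (inj₁ p) eq   | nothing with lastBorn k p in e′
lastBorn⇒parent (suc k) (inj₁ p) refl | nothing | just w rewrite lastBorn⇒parent k p e′ = refl
lastBorn⇒parent (suc k) (inj₂ (inj₁ (S , p))) eq with lastBorn k p in e
lastBorn⇒parent (suc k) (inj₂ (inj₁ (S , p))) refl | just w rewrite lastBorn⇒parent k p e = refl

lastBorn⇒arcs≡[] : ∀ k p {u} → lastBorn k p ≡ just u → arcs k u ≡ []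
lastBorn⇒arcs≡[] (suc k) (inj₁ p) eq with leafLabel k p
lastBorn⇒arcs≡[] (suc k) (inj₁ p) refl | just S rewrite arcs-root k = refl
lastBorn⇒arcs≡[] (suc k) (inj₁ p) eq   | nothing with lastBorn k p in e
lastBorn⇒arcs≡[] (suc k) (inj₁ p) refl | nothing | just w rewrite lastBorn⇒arcs≡[] k p e = refl
lastBorn⇒arcs≡[] (suc k) (inj₂ (inj₁ (S , p))) eq with lastBorn k p in e
lastBorn⇒arcs≡[] (suc k) (inj₂ (inj₁ (S , p))) refl | just w rewrite lastBorn⇒arcs≡[] k p e = refl

parent-inj₁ : ∀ k {u a} → parent k u ≡ just a → parent (suc k) (inj₁ u) ≡ just (inj₁ a)
parent-inj₁ k e rewrite e = refl

parent-copy : ∀ k S {u a} → parent k u ≡ just a → parent (suc k) (copy S u) ≡ just (copy S a)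
parent-copy k S e rewrite e = refl

Branch-map : ∀ {k k′} (f : BV k → BV k′) →
             (∀ {u a} → parent k u ≡ just a → parent k′ (f u) ≡ just (f a)) →
             ∀ {a b l} → Branch k a b l → Branch k′ (f a) (f b) (map f l)
Branch-map f f-parent [ a ]    = [ f a ]
Branch-map f f-parent (e ◅ br) = f-parent e ◅ Branch-map f f-parent br

Branch-++ : ∀ {k a b c d l l′} → Branch k a b l → parent k c ≡ just b → Branch k c d l′ →
            Branch k a d (l ++ l′)
Branch-++ [ a ]     e br′ = e ◅ br′
Branch-++ (e₀ ◅ br) e br′ = e₀ ◅ Branch-++ br e br′

branch-Branch : ∀ k S → Branch k (root k) (leaf k S) (branch k S)
branch-Branch zero    _               = [ tt ]
branch-Branch (suc k) (S , Q , true)  =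
  Branch-++ (Branch-map inj₁ (parent-inj₁ k) (branch-Branch k S)) copy-root
            (Branch-map (copy S) (parent-copy k S) (branch-Branch k Q))
  where
  copy-root : parent (suc k) (copy S (root k)) ≡ just (inj₁ (leaf k S))
  copy-root rewrite parent-root k = refl
branch-Branch (suc k) (S , Q , false) =
  Branch-++ (Branch-map inj₁ (parent-inj₁ k) (branch-Branch k S)) refl [ new S Q ]

arcs-Branch : ∀ k u {p} → parent k u ≡ just p →
  (lastBorn k p ≡ just u) ⊎ (arcs k u ≡ []) ⊎
  (Σ (BV k) λ w → lastBorn k p ≡ just w × ∃ λ b → Branch k w b (arcs k u))
arcs-Branch (suc k) (inj₁ u) eq with parent k u in e
arcs-Branch (suc k) (inj₁ u) refl | just q rewrite parent⇒not-leaf k u e with arcs-Branch k u e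
... | inj₁ x rewrite x = inj₁ refl
... | inj₂ (inj₁ x) rewrite x = inj₂ (inj₁ refl)
... | inj₂ (inj₂ (w , x , b , br)) rewrite x =
  inj₂ (inj₂ (inj₁ w , refl , inj₁ b , Branch-map inj₁ (parent-inj₁ k) br))
arcs-Branch (suc k) (inj₂ (inj₁ (S , u))) eq with parent k u in e
arcs-Branch (suc k) (inj₂ (inj₁ (S , u))) refl | just q with arcs-Branch k u e
... | inj₁ x rewrite x = inj₁ refl
... | inj₂ (inj₁ x) rewrite x = inj₂ (inj₁ refl)
... | inj₂ (inj₂ (w , x , b , br)) rewrite x =
  inj₂ (inj₂ (copy S w , refl , copy S b , Branch-map (copy S) (parent-copy k S) br))
arcs-Branch (suc k) (inj₂ (inj₁ (S , u))) refl | nothing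
  rewrite leafLabel-leaf k S | parent≡nothing⇒root k u e = inj₁ refl
arcs-Branch (suc k) (inj₂ (inj₂ (S , Q))) refl rewrite leafLabel-leaf k S =
  inj₂ (inj₂ (copy S (root k) , refl , copy S (leaf k Q) ,
               Branch-map (copy S) (parent-copy k S) (branch-Branch k Q)))

Bmem⇒∈branch : ∀ k S v → Bmem k S v → v ∈ branch k S
Bmem⇒∈branch zero    _               _ _ = here refl
Bmem⇒∈branch (suc k) (S , Q , true)  (inj₁ v) m =
  ∈-++⁺ˡ (∈-map⁺ inj₁ (Bmem⇒∈branch k S v m))
Bmem⇒∈branch (suc k) (S , Q , true)  (inj₂ (inj₁ (S , v))) (refl , m) =
  ∈-++⁺ʳ (map inj₁ (branch k S)) (∈-map⁺ (copy S) (Bmem⇒∈branch k Q v m))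
Bmem⇒∈branch (suc k) (S , Q , false) (inj₁ v) m =
  ∈-++⁺ˡ (∈-map⁺ inj₁ (Bmem⇒∈branch k S v m))
Bmem⇒∈branch (suc k) (S , Q , false) (inj₂ (inj₂ (S , Q))) refl =
  ∈-++⁺ʳ (map inj₁ (branch k S)) (here refl)

∈branch⇒Bmem : ∀ k S v → v ∈ branch k S → Bmem k S v
∈branch⇒Bmem zero _ _ _ = tt
∈branch⇒Bmem (suc k) (S , Q , true) v m with ∈-++⁻ (map inj₁ (branch k S)) m
∈branch⇒Bmem (suc k) (S , Q , true) (inj₁ v) m | inj₁ m₁ =
  ∈branch⇒Bmem k S v (∈-map-injective inj₁-injective m₁)
∈branch⇒Bmem (suc k) (S , Q , true) (inj₂ _) m | inj₁ m₁ = ⊥-elim (∉-map inj₁ (λ _ ()) m₁)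
∈branch⇒Bmem (suc k) (S , Q , true) v m | inj₂ m₂ with ∈-map⁻ (copy S) m₂
... | u , u∈ , refl = refl , ∈branch⇒Bmem k Q u u∈
∈branch⇒Bmem (suc k) (S , Q , false) v m with ∈-++⁻ (map inj₁ (branch k S)) m
∈branch⇒Bmem (suc k) (S , Q , false) (inj₁ v) m | inj₁ m₁ =
  ∈branch⇒Bmem k S v (∈-map-injective inj₁-injective m₁)
∈branch⇒Bmem (suc k) (S , Q , false) (inj₂ _) m | inj₁ m₁ = ⊥-elim (∉-map inj₁ (λ _ ()) m₁)
∈branch⇒Bmem (suc k) (S , Q , false) v m | inj₂ (here refl) = refl

BAdj-sym : ∀ k u v → BAdj k u v → BAdj k v u
BAdj-sym (suc k) (inj₁ u)              (inj₁ v)              a          = BAdj-sym k u v a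
BAdj-sym (suc k) (inj₂ (inj₁ (S , u))) (inj₂ (inj₁ (S , v))) (refl , a) = refl , BAdj-sym k u v a
BAdj-sym (suc k) (inj₂ (inj₁ _))       (inj₂ (inj₂ _))       a          = a
BAdj-sym (suc k) (inj₂ (inj₂ _))       (inj₂ (inj₁ _))       a          = a

∈arcs⇒BAdj : ∀ k u v → v ∈ arcs k u → BAdj k u v
∈arcs⇒BAdj (suc k) (inj₁ u) (inj₁ v) m = ∈arcs⇒BAdj k u v (∈-map-injective inj₁-injective m)
∈arcs⇒BAdj (suc k) (inj₁ u) (inj₂ v) m = ⊥-elim (∉-map inj₁ (λ _ ()) m)
∈arcs⇒BAdj (suc k) (inj₂ (inj₁ (S , u))) v m with ∈-map⁻ (copy S) m
... | w , w∈ , refl = refl , ∈arcs⇒BAdj k u w w∈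
∈arcs⇒BAdj (suc k) (inj₂ (inj₂ (S , Q))) v m with ∈-map⁻ (copy S) m
... | w , w∈ , refl = refl , ∈branch⇒Bmem k Q w w∈

BAdj⇒∈arcs : ∀ k u v → BAdj k u v → v ∈ arcs k u ⊎ u ∈ arcs k v
BAdj⇒∈arcs (suc k) (inj₁ u) (inj₁ v) a with BAdj⇒∈arcs k u v a
... | inj₁ m = inj₁ (∈-map⁺ inj₁ m)
... | inj₂ m = inj₂ (∈-map⁺ inj₁ m)
BAdj⇒∈arcs (suc k) (inj₂ (inj₁ (S , u))) (inj₂ (inj₁ (S , v))) (refl , a)
  with BAdj⇒∈arcs k u v a
... | inj₁ m = inj₁ (∈-map⁺ (copy S) m)
... | inj₂ m = inj₂ (∈-map⁺ (copy S) m)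
BAdj⇒∈arcs (suc k) (inj₂ (inj₁ (S , u))) (inj₂ (inj₂ (S , Q))) (refl , m) =
  inj₂ (∈-map⁺ (copy S) (Bmem⇒∈branch k Q u m))
BAdj⇒∈arcs (suc k) (inj₂ (inj₂ (S , Q))) (inj₂ (inj₁ (S , u))) (refl , m) =
  inj₁ (∈-map⁺ (copy S) (Bmem⇒∈branch k Q u m))

labels : ℕ → ℕ
labels zero    = 1
labels (suc k) = labels k * (labels k * 2)

size : ℕ → ℕ
size zero    = 0
size (suc k) = size k + (labels k * suc (size k) + labels k * labels k)

labelIndex : ∀ k → Fin (labels k) ↔ BI k
labelIndex zero    = 1↔⊤
labelIndex (suc k) = ↔-trans *↔× (labelIndex k ×-↔ ↔-trans *↔× (labelIndex k ×-↔ 2↔Bool))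

vertexIndex : ∀ k → Fin (suc (size k)) ↔ BV k
vertexIndex zero    = 1↔⊤
vertexIndex (suc k) =
  ↔-trans +↔⊎ (vertexIndex k ⊎-↔ ↔-trans +↔⊎
    (↔-trans *↔× (labelIndex k ×-↔ vertexIndex k) ⊎-↔
     ↔-trans *↔× (labelIndex k ×-↔ labelIndex k)))

labelCode : ∀ k → BI k → Fin (labels k)
labelCode k = Inverse.from (labelIndex k)

code : ∀ k → BV k → Fin (suc (size k))
code k = Inverse.from (vertexIndex k)

decode : ∀ k → Fin (suc (size k)) → BV k
decode k = Inverse.to (vertexIndex k)

decode-code : ∀ k v → decode k (code k v) ≡ v
decode-code k = Inverse.strictlyInverseˡ (vertexIndex k)

code-decode : ∀ k i → code k (decode k i) ≡ i
code-decode k = Inverse.strictlyInverseʳ (vertexIndex k)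

code-injective : ∀ k {u v} → code k u ≡ code k v → u ≡ v
code-injective k {u} {v} e = trans (sym (decode-code k u)) (trans (cong (decode k) e) (decode-code k v))

code-root : ∀ k → code k (root k) ≡ zero
code-root zero    = refl
code-root (suc k) rewrite code-root k = refl

↑ˡ<↑ʳ : ∀ {m n} (i : Fin m) (j : Fin n) → toℕ (i ↑ˡ n) < toℕ (m ↑ʳ j)
↑ˡ<↑ʳ {m} {n} i j rewrite toℕ-↑ˡ i n | toℕ-↑ʳ m j = <-≤-trans (toℕ<n i) (m≤m+n m (toℕ j))

code-parent< : ∀ k v {p} → parent k v ≡ just p → toℕ (code k p) < toℕ (code k v)
code-parent< (suc k) (inj₁ v) e with parent k v in e′
code-parent< (suc k) (inj₁ v) refl | just q
  rewrite toℕ-↑ˡ (code k q) (labels k * suc (size k) + labels k * labels k)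
        | toℕ-↑ˡ (code k v) (labels k * suc (size k) + labels k * labels k) = code-parent< k v e′
code-parent< (suc k) (inj₂ (inj₁ (S , v))) e with parent k v in e′
code-parent< (suc k) (inj₂ (inj₁ (S , v))) refl | just q
  rewrite toℕ-↑ʳ (suc (size k)) (combine (labelCode k S) (code k q) ↑ˡ (labels k * labels k))
        | toℕ-↑ʳ (suc (size k)) (combine (labelCode k S) (code k v) ↑ˡ (labels k * labels k))
        | toℕ-↑ˡ (combine (labelCode k S) (code k q)) (labels k * labels k)
        | toℕ-↑ˡ (combine (labelCode k S) (code k v)) (labels k * labels k)
        | toℕ-combine (labelCode k S) (code k q)
        | toℕ-combine (labelCode k S) (code k v) =
  +-monoʳ-< (suc (size k)) (+-monoʳ-< (suc (size k) * toℕ (labelCode k S)) (code-parent< k v e′))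
code-parent< (suc k) (inj₂ (inj₁ (S , v))) refl | nothing = ↑ˡ<↑ʳ (code k (leaf k S)) _
code-parent< (suc k) (inj₂ (inj₂ (S , Q))) refl = ↑ˡ<↑ʳ (code k (leaf k S)) _

module SequenceTree (k : ℕ) where

  suc⇒parent : ∀ i → ∃ λ p → parent k (decode k (suc i)) ≡ just p
  suc⇒parent i with parent k (decode k (suc i)) in e
  ... | just p  = p , refl
  ... | nothing with trans (sym (code-decode k (suc i)))
                           (trans (cong (code k) (parent≡nothing⇒root k _ e)) (code-root k))
  ...   | ()

  par : Fin (size k) → Fin (suc (size k))
  par i = code k (fromMaybe (root k) (parent k (decode k (suc i))))

  open TreeDefs par

  parent⇒IsParent : ∀ {v p} → parent k v ≡ just p → IsParent (code k p) (code k v)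
  parent⇒IsParent {v} e with code k v in eq
  ... | zero rewrite code-injective k (trans eq (sym (code-root k))) | parent-root k with e
  ...   | ()
  parent⇒IsParent {v} e | suc i rewrite sym eq | decode-code k v | e = refl

  IsParent⇒parent : ∀ x y → IsParent x y → parent k (decode k y) ≡ just (decode k x)
  IsParent⇒parent x (suc i) refl with suc⇒parent i
  ... | p , e rewrite e | decode-code k p = refl

  par≤ : ∀ i → toℕ (par i) ≤ toℕ i
  par≤ i with suc⇒parent i
  ... | p , e with code-parent< k (decode k (suc i)) e
  ...   | lt rewrite e | code-decode k (suc i) = ≤-pred lt

  lb : Fin (suc (size k)) → Maybe (Fin (suc (size k)))
  lb x = Maybe.map (code k) (lastBorn k (decode k x))

  c : Fin (suc (size k)) → List (Fin (suc (size k)))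
  c x = map (code k) (arcs k (decode k x))

  lb-child : ∀ v u → lb v ≡ just u → IsParent v u
  lb-child v u e with lastBorn k (decode k v) in e₁
  lb-child v _ refl | just w with parent⇒IsParent (lastBorn⇒parent k (decode k v) e₁)
  ... | r rewrite code-decode k v = r

  lb-leaf : ∀ v → lb v ≡ nothing → ∀ u → ¬ IsParent v u
  lb-leaf v e u ip with parent⇒lastBorn k (decode k u) (IsParent⇒parent v u ip)
  ... | w , e₂ rewrite e₂ with e
  ... | ()

  c-root : c zero ≡ []
  c-root rewrite sym (code-root k) | decode-code k (root k) | arcs-root k = refl

  c-lastborn : ∀ v u → lb v ≡ just u → c u ≡ []
  c-lastborn v u e with lastBorn k (decode k v) in e₁
  c-lastborn v _ refl | just w rewrite decode-code k w | lastBorn⇒arcs≡[] k (decode k v) e₁ = refl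

  Branch⇒BranchFrom : ∀ {a b l} → Branch k a b l → BranchFrom (code k a) (map (code k) l)
  Branch⇒BranchFrom [ a ]                 = single
  Branch⇒BranchFrom (e ◅ [ u ])           = step (parent⇒IsParent e) single
  Branch⇒BranchFrom (e ◅ br@(_ ◅ _))      = step (parent⇒IsParent e) (Branch⇒BranchFrom br)

  c-branch : ∀ i → (¬ ∃ λ v → lb v ≡ just (suc i)) →
             (c (suc i) ≡ []) ⊎
             (Σ (Fin (suc (size k))) λ w → (lb (par i) ≡ just w) × BranchFrom w (c (suc i)))
  c-branch i not-lastBorn with suc⇒parent i
  ... | p , e rewrite e with arcs-Branch k (decode k (suc i)) e
  ... | inj₁ lb≡ = ⊥-elim (not-lastBorn (code k p , lb-p))
    where
    lb-p : lb (code k p) ≡ just (suc i)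
    lb-p rewrite decode-code k p | lb≡ | code-decode k (suc i) = refl
  ... | inj₂ (inj₁ arcs≡[]) rewrite arcs≡[] = inj₁ refl
  ... | inj₂ (inj₂ (w , lb≡ , b , br)) = inj₂ (code k w , lb-p , Branch⇒BranchFrom br)
    where
    lb-p : lb (code k p) ≡ just (code k w)
    lb-p rewrite decode-code k p | lb≡ = refl

  tree : BurlingTree
  tree = record
    { m = size k ; par = par ; par≤ = par≤ ; lb = lb ; lb-child = lb-child ; lb-leaf = lb-leaf
    ; c = c ; c-root = c-root ; c-lastborn = c-lastborn ; c-branch = c-branch }

  BAdj⇔UAdj : ∀ u v → BAdj k u v ⇔ BurlingTree.UAdj tree (code k u) (code k v)
  BAdj⇔UAdj u v = mk⇔ to from
    where
    to : BAdj k u v → BurlingTree.UAdj tree (code k u) (code k v)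
    to a with BAdj⇒∈arcs k u v a
    ... | inj₁ m rewrite decode-code k u = inj₁ (∈-map⁺ (code k) m)
    ... | inj₂ m rewrite decode-code k v = inj₂ (∈-map⁺ (code k) m)
    from : BurlingTree.UAdj tree (code k u) (code k v) → BAdj k u v
    from (inj₁ m) rewrite decode-code k u = ∈arcs⇒BAdj k u v (∈-map-injective (code-injective k) m)
    from (inj₂ m) rewrite decode-code k v =
      BAdj-sym k v u (∈arcs⇒BAdj k v u (∈-map-injective (code-injective k) m))

IsoToInduced-∘ : ∀ {H W W′ R} {R′ : W′ → W′ → Set} → IsoToInduced H W R →
                 (g : W → W′) → Injective _≡_ _≡_ g → (∀ a b → R a b ⇔ R′ (g a) (g b)) →
                 IsoToInduced H W′ R′
IsoToInduced-∘ (f , f-injective , f-adjacent) g g-injective g-adjacent =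
  g ∘ f , f-injective ∘ g-injective , λ x y → g-adjacent (f x) (f y) ⇔-∘ f-adjacent x y

burling⇒derived : ∀ H → IsBurlingGraph H → IsDerivedGraph H
burling⇒derived H (k , iso) =
  tree , IsoToInduced-∘ {H = H} {R = BAdj k} {R′ = BurlingTree.UAdj tree}
                        iso (code k) (code-injective k) BAdj⇔UAdj
  where open SequenceTree k

∈-≡[] : ∀ {A : Set} {x : A} {l} → l ≡ [] → x ∈ l → ⊥
∈-≡[] refl ()

module Ancestry (T : BurlingTree) where
  open BurlingTree T

  infix 4 _≼_

  data _≼_ : Vertex → Vertex → Set where
    ≼-refl : ∀ {z} → z ≼ z
    ≼-step : ∀ {z i} → z ≼ par i → z ≼ suc i

  ≼⇒≤ : ∀ {a b} → a ≼ b → toℕ a ≤ toℕ b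
  ≼⇒≤ ≼-refl = ≤-refl
  ≼⇒≤ {b = suc i} (≼-step p) = ≤-trans (≼⇒≤ p) (≤-trans (par≤ i) (n≤1+n (toℕ i)))

  ≼-trans : ∀ {a b c} → a ≼ b → b ≼ c → a ≼ c
  ≼-trans p ≼-refl     = p
  ≼-trans p (≼-step q) = ≼-step (≼-trans p q)

  ≼-antisym : ∀ {a b} → a ≼ b → b ≼ a → a ≡ b
  ≼-antisym ≼-refl _ = refl
  ≼-antisym {b = suc i} (≼-step p) q =
    ⊥-elim (<-irrefl refl (<-≤-trans (s≤s (≤-trans (≼⇒≤ p) (par≤ i))) (≼⇒≤ q)))

  ≼-comparable : ∀ {a b x} → a ≼ x → b ≼ x → a ≼ b ⊎ b ≼ a
  ≼-comparable ≼-refl     q          = inj₂ q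
  ≼-comparable (≼-step p) ≼-refl     = inj₁ (≼-step p)
  ≼-comparable (≼-step p) (≼-step q) = ≼-comparable p q

  ≼-par : ∀ {a j} → a ≼ suc j → a ≢ suc j → a ≼ par j
  ≼-par ≼-refl     ne = ⊥-elim (ne refl)
  ≼-par (≼-step p) _  = p

  child⇒< : ∀ {a b} → IsParent a b → toℕ a < toℕ b
  child⇒< {b = suc i} refl = s≤s (par≤ i)

  child⇒≼ : ∀ {a b} → IsParent a b → a ≼ b
  child⇒≼ {b = suc i} refl = ≼-step ≼-refl

  child⋠parent : ∀ {z ch} → IsParent z ch → ch ≼ z → ⊥
  child⋠parent pc q = <-irrefl refl (<-≤-trans (child⇒< pc) (≼⇒≤ q))

  ≼⇒≡⊎via-child : ∀ {z y} → z ≼ y → y ≡ z ⊎ (Σ Vertex λ ch → IsParent z ch × ch ≼ y)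
  ≼⇒≡⊎via-child ≼-refl = inj₁ refl
  ≼⇒≡⊎via-child {y = suc i} (≼-step p) with ≼⇒≡⊎via-child p
  ... | inj₁ e              = inj₂ (suc i , e , ≼-refl)
  ... | inj₂ (ch , pc , q)  = inj₂ (ch , pc , ≼-step q)

  children-≼⇒≡ : ∀ {z a b} → IsParent z a → IsParent z b → a ≼ b → a ≡ b
  children-≼⇒≡ pa pb ≼-refl = refl
  children-≼⇒≡ {b = suc j} pa refl (≼-step q) = ⊥-elim (child⋠parent pa q)

  child-≼-unique : ∀ {z a b y} → IsParent z a → IsParent z b → a ≼ y → b ≼ y → a ≡ b
  child-≼-unique pa pb qa qb with ≼-comparable qa qb
  ... | inj₁ ab = children-≼⇒≡ pa pb ab
  ... | inj₂ ba = sym (children-≼⇒≡ pb pa ba)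

  root≼ : ∀ v → zero ≼ v
  root≼ v = bounded m v (≤-pred (toℕ<n v))
    where
    bounded : ∀ n (x : Vertex) → toℕ x ≤ n → zero ≼ x
    bounded n       zero    _       = ≼-refl
    bounded (suc n) (suc i) (s≤s h) = ≼-step (bounded n (par i) (≤-trans (par≤ i) h))

  _≼?_ : ∀ z y → Dec (z ≼ y)
  z ≼? y = bounded (suc m) y (toℕ<n y)
    where
    bounded : ∀ n y → toℕ y < n → Dec (z ≼ y)
    bounded (suc n) y h with z ≟ᶠ y
    ... | yes refl = yes ≼-refl
    bounded (suc n) zero    h       | no ne = no λ { ≼-refl → ne refl }
    bounded (suc n) (suc i) (s≤s h) | no ne with bounded n (par i) (≤-<-trans (par≤ i) h)
    ...   | yes p = yes (≼-step p)
    ...   | no np = no λ { ≼-refl → ne refl ; (≼-step p) → np p }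

  BranchFrom⇒interval : ∀ {w l} → BranchFrom w l →
    Σ Vertex λ b → w ≼ b × (∀ y → y ∈ l ⇔ (w ≼ y × y ≼ b))
  BranchFrom⇒interval {w} single =
    w , ≼-refl ,
    λ y → mk⇔ (λ { (here refl) → ≼-refl , ≼-refl }) (λ (w≼y , y≼w) → here (≼-antisym y≼w w≼y))
  BranchFrom⇒interval {w} (step {u = suc j} refl bf) with BranchFrom⇒interval bf
  ... | b , u≼b , interval = b , ≼-trans w≼u u≼b , λ y → mk⇔ (to y) (from y)
    where
    w≼u : w ≼ suc j
    w≼u = ≼-step ≼-refl
    to : ∀ y → y ∈ w ∷ suc j ∷ _ → w ≼ y × y ≼ b
    to y (here refl) = ≼-refl , ≼-trans w≼u u≼b
    to y (there y∈) with Equivalence.to (interval y) y∈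
    ... | u≼y , y≼b = ≼-trans w≼u u≼y , y≼b
    from : ∀ y → w ≼ y × y ≼ b → y ∈ w ∷ suc j ∷ _
    from y (w≼y , y≼b) with y ≟ᶠ w | ≼-comparable u≼b y≼b
    ... | yes refl | _                 = here refl
    ... | no _     | inj₁ u≼y          = there (Equivalence.from (interval y) (u≼y , y≼b))
    ... | no _     | inj₂ ≼-refl       = there (Equivalence.from (interval y) (≼-refl , y≼b))
    ... | no y≢w   | inj₂ (≼-step y≼w) = ⊥-elim (y≢w (≼-antisym y≼w w≼y))

  arc⇒below-last-born-sibling : ∀ {x y} → y ∈ c x →
    Σ (Fin m) λ j → x ≡ suc j × lb (par j) ≢ just x ×
                    Σ Vertex λ w → lb (par j) ≡ just w × w ≼ y
  arc⇒below-last-born-sibling {zero} y∈ = ⊥-elim (∈-≡[] c-root y∈)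
  arc⇒below-last-born-sibling {suc j} {y} y∈ with c-branch j not-last-born
    where
    not-last-born : ¬ ∃ λ v → lb v ≡ just (suc j)
    not-last-born (v , e) = ∈-≡[] (c-lastborn v (suc j) e) y∈
  ... | inj₁ c≡[] = ⊥-elim (∈-≡[] c≡[] y∈)
  ... | inj₂ (w , e , bf) =
    j , refl , (λ e′ → ∈-≡[] (c-lastborn (par j) (suc j) e′) y∈) ,
    w , e , proj₁ (Equivalence.to (proj₂ (proj₂ (BranchFrom⇒interval bf)) y) y∈)

  arc-below : ∀ {z x y} → z ≼ x → z ≼ y → y ∈ c x →
      (IsParent z x × lb z ≢ just x × Σ Vertex λ w → lb z ≡ just w × w ≼ y)
    ⊎ (Σ Vertex λ ch → IsParent z ch × ch ≼ x × ch ≼ y × ch ≢ x × ch ≢ y)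
  arc-below {z} {x} {y} z≼x z≼y y∈ with arc⇒below-last-born-sibling y∈
  ... | j , refl , not-lb , w , lb≡w , w≼y with lb-child (par j) w lb≡w | ≼⇒≡⊎via-child z≼x
  ... | pw | inj₁ refl = ⊥-elim (not-lb (trans lb≡w (cong just (child-≼-unique pw refl w≼y z≼y))))
  ... | pw | inj₂ (ch , pc , ch≼x) with ch ≟ᶠ suc j
  ...   | yes refl = inj₁ (pc , subst (λ v → lb v ≢ just x) pc not-lb ,
                           w , subst (λ v → lb v ≡ just w) pc lb≡w , w≼y)
  ...   | no ch≢x = inj₂ (ch , pc , ch≼x , ≼-trans ch≼w w≼y , ch≢x , ch≢y)
    where
    ch≼w : ch ≼ w
    ch≼w = ≼-trans (≼-par ch≼x ch≢x) (child⇒≼ pw)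
    ch≢y : ch ≢ y
    ch≢y refl = child⋠parent pw (≼-trans w≼y (≼-par ch≼x ch≢x))

Bmem-root : ∀ k S → Bmem k S (root k)
Bmem-root zero    _               = tt
Bmem-root (suc k) (S , Q , true)  = Bmem-root k S
Bmem-root (suc k) (S , Q , false) = Bmem-root k S

BAdj-root : ∀ k v → ¬ BAdj k (root k) v
BAdj-root (suc k) (inj₁ v) a = BAdj-root k v a

label : ∀ k → ℕ → BI k
label zero    _       = tt
label (suc k) zero    = label k 0 , label k 0 , true
label (suc k) (suc n) = label k n , label k 0 , false

label-injective : ∀ k {a b} → a ≤ k → b ≤ k → label k a ≡ label k b → a ≡ b
label-injective zero    z≤n     z≤n     _ = refl
label-injective (suc k) {zero}  {zero}  _ _ _ = refl
label-injective (suc k) {suc a} {suc b} (s≤s a≤k) (s≤s b≤k) e =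
  cong suc (label-injective k a≤k b≤k (cong proj₁ e))

module SubtreeEmbedding (T : BurlingTree) where
  open BurlingTree T
  open Ancestry T

  record IsEmbedding (z : Vertex) {K : ℕ} (ψ : Vertex → BV K) (σ : Vertex → BI K) : Set where
    field
      ψ-root      : ψ z ≡ root K
      ψ-injective : ∀ {x y} → z ≼ x → z ≼ y → ψ x ≡ ψ y → x ≡ y
      ψ-adjacent  : ∀ {x y} → z ≼ x → z ≼ y → UAdj x y ⇔ BAdj K (ψ x) (ψ y)
      σ-branch    : ∀ {x y} → z ≼ x → z ≼ y → y ≼ x ⇔ Bmem K (σ x) (ψ y)

  record Embedding (z : Vertex) (K : ℕ) : Set where
    field
      ψ           : Vertex → BV K
      σ           : Vertex → BI K
      isEmbedding : IsEmbedding z ψ σ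

  liftψ : ∀ {K} → (Vertex → BV K) → Vertex → BV (suc K)
  liftψ ψ x = inj₁ (ψ x)

  liftσ : ∀ {K} → (Vertex → BI K) → Vertex → BI (suc K)
  liftσ σ x = σ x , σ x , true

  lift : ∀ {z K} {ψ : Vertex → BV K} {σ} → IsEmbedding z ψ σ → IsEmbedding z (liftψ ψ) (liftσ σ)
  lift E = record
    { ψ-root      = cong inj₁ ψ-root
    ; ψ-injective = λ zx zy e → ψ-injective zx zy (inj₁-injective e)
    ; ψ-adjacent  = ψ-adjacent
    ; σ-branch    = σ-branch
    }
    where open IsEmbedding E

  module Step (z : Vertex) (K : ℕ) (m+2≤K : m + 2 ≤ K)
              (sub : ∀ z′ → toℕ z < toℕ z′ → Embedding z′ K) where

    -- Total in ch, so usable without a proof that ch is a child of z; sub-isEmbedding gives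
    -- their meaning on children.
    ψ↓ : Vertex → Vertex → BV K
    ψ↓ ch with toℕ z <? toℕ ch
    ... | yes z<ch = Embedding.ψ (sub ch z<ch)
    ... | no _     = λ _ → root K

    σ↓ : Vertex → Vertex → BI K
    σ↓ ch with toℕ z <? toℕ ch
    ... | yes z<ch = Embedding.σ (sub ch z<ch)
    ... | no _     = λ _ → label K 0

    sub-isEmbedding : ∀ {ch} → IsParent z ch → IsEmbedding ch (ψ↓ ch) (σ↓ ch)
    sub-isEmbedding {ch} pc with toℕ z <? toℕ ch
    ... | yes z<ch = Embedding.isEmbedding (sub ch z<ch)
    ... | no z≮ch  = ⊥-elim (z≮ch (child⇒< pc))

    S-last S-isolated S-root : BI (suc K)
    S-last     = label (suc K) 0
    S-isolated = label (suc K) 1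
    S-root     = label (suc K) 2

    2≤1+K : 2 ≤ suc K
    2≤1+K = ≤-trans (m≤n+m 2 m) (≤-trans m+2≤K (n≤1+n K))

    S-last≢S-isolated : S-last ≢ S-isolated
    S-last≢S-isolated e with label-injective (suc K) z≤n (≤-trans (s≤s z≤n) 2≤1+K) e
    ... | ()

    S-last≢S-root : S-last ≢ S-root
    S-last≢S-root e with label-injective (suc K) z≤n 2≤1+K e
    ... | ()

    S-isolated≢S-root : S-isolated ≢ S-root
    S-isolated≢S-root e with label-injective (suc K) (≤-trans (s≤s z≤n) 2≤1+K) 2≤1+K e
    ... | ()

    vertex≤K : ∀ (v : Vertex) → toℕ v ≤ K
    vertex≤K v = ≤-trans (≤-pred (toℕ<n v)) (≤-trans (m≤m+n m 2) m+2≤K)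

    NonLast : Vertex → Set
    NonLast ch = IsParent z ch × lb z ≢ just ch

    no-parent-has-last-born : ∀ {j} → par j ≡ z → lb z ≢ just (suc j) →
                              ¬ ∃ λ v → lb v ≡ just (suc j)
    no-parent-has-last-born {j} pj not-last (v , e) =
      not-last (subst (λ u → lb u ≡ just (suc j)) (trans (sym (lb-child v (suc j) e)) pj) e)

    -- A non-last child ch becomes v_{S,Q} for (S , Q) = childLabel ch.  If c(ch) is the branch
    -- from the last-born w to b, Q consists of the stable set cutting out w..b in the embedding
    -- of w's subtree plus a fresh vertex; if c(ch) is empty, S = S-isolated indexes a copy
    -- disjoint from the image.
    childLabel : Vertex → BI (suc K) × BI (suc K)
    childLabel zero = S-root , S-root
    childLabel (suc j) with par j ≟ᶠ z | ≡-decᵐ _≟ᶠ_ (lb z) (just (suc j))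
    ... | no _   | _     = S-root , S-root
    ... | yes _  | yes _ = S-root , S-root
    ... | yes pj | no not-last with c-branch j (no-parent-has-last-born pj not-last)
    ...   | inj₁ _            = S-isolated , label (suc K) (toℕ (suc j))
    ...   | inj₂ (w , _ , bf) =
      S-last , (σ↓ w (proj₁ (BranchFrom⇒interval bf)) , label K (toℕ (suc j)) , false)

    childLabel-spec : ∀ {ch} → NonLast ch →
        (c ch ≡ [] × childLabel ch ≡ (S-isolated , label (suc K) (toℕ ch)))
      ⊎ (Σ Vertex λ w → lb z ≡ just w × Σ Vertex λ b → w ≼ b ×
           (∀ y → y ∈ c ch ⇔ (w ≼ y × y ≼ b)) ×
           childLabel ch ≡ (S-last , (σ↓ w b , label K (toℕ ch) , false)))
    childLabel-spec {suc j} (pc , nl) with par j ≟ᶠ z | ≡-decᵐ _≟ᶠ_ (lb z) (just (suc j))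
    ... | no ¬pj | _     = ⊥-elim (¬pj pc)
    ... | yes _  | yes e = ⊥-elim (nl e)
    ... | yes pj | no not-last with c-branch j (no-parent-has-last-born pj not-last)
    ...   | inj₁ c≡[] = inj₁ (c≡[] , refl)
    ...   | inj₂ (w , e , bf) with BranchFrom⇒interval bf
    ...     | b , w≼b , interval =
      inj₂ (w , subst (λ u → lb u ≡ just w) pj e , b , w≼b , interval , refl)

    childLabel≢root : ∀ {ch} → NonLast ch → proj₁ (childLabel ch) ≢ S-root
    childLabel≢root nl with childLabel-spec nl
    ... | inj₁ (_ , e)                     rewrite e = S-isolated≢S-root
    ... | inj₂ (_ , _ , _ , _ , _ , e) rewrite e = S-last≢S-root

    childLabel-injective : ∀ {ch ch′} → NonLast ch → NonLast ch′ →
                           childLabel ch ≡ childLabel ch′ → ch ≡ ch′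
    childLabel-injective {ch} {ch′} nl nl′ eq with childLabel-spec nl | childLabel-spec nl′
    ... | inj₁ (_ , e) | inj₁ (_ , e′) rewrite e | e′ =
      toℕ-injective (label-injective (suc K) (≤-trans (vertex≤K ch) (n≤1+n K))
                                              (≤-trans (vertex≤K ch′) (n≤1+n K)) (cong proj₂ eq))
    ... | inj₁ (_ , e) | inj₂ (_ , _ , _ , _ , _ , e′) rewrite e | e′ =
      ⊥-elim (S-last≢S-isolated (sym (cong proj₁ eq)))
    ... | inj₂ (_ , _ , _ , _ , _ , e) | inj₁ (_ , e′) rewrite e | e′ =
      ⊥-elim (S-last≢S-isolated (cong proj₁ eq))
    ... | inj₂ (_ , _ , _ , _ , _ , e) | inj₂ (_ , _ , _ , _ , _ , e′) rewrite e | e′ =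
      toℕ-injective (label-injective K (vertex≤K ch) (vertex≤K ch′)
                                      (cong (λ p → proj₁ (proj₂ (proj₂ p))) eq))

    childSet : Vertex → BI (suc (suc K))
    childSet ch = proj₁ (childLabel ch) , proj₂ (childLabel ch) , false

    childVertex : Vertex → BV (suc (suc K))
    childVertex ch = new (proj₁ (childLabel ch)) (proj₂ (childLabel ch))

    childSet-injective : ∀ {ch ch′} → NonLast ch → NonLast ch′ → childSet ch ≡ childSet ch′ → ch ≡ ch′
    childSet-injective nl nl′ e =
      childLabel-injective nl nl′ (cong (λ t → proj₁ t , proj₁ (proj₂ t)) e)

    ψ⇈ : Vertex → Vertex → BV (suc (suc K))
    ψ⇈ ch = liftψ (liftψ (ψ↓ ch))

    σ⇈ : Vertex → Vertex → BI (suc (suc K))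
    σ⇈ ch = liftσ (liftσ (σ↓ ch))

    data Region (y : Vertex) : Set where
      at-z     : y ≡ z → Region y
      in-last  : ∀ w → lb z ≡ just w → w ≼ y → Region y
      at-child : ∀ ch → NonLast ch → y ≡ ch → Region y
      in-child : ∀ ch → NonLast ch → ch ≼ y → y ≢ ch → Region y

    region : ∀ {y} → z ≼ y → Region y
    region {y} z≼y with ≼⇒≡⊎via-child z≼y
    ... | inj₁ y≡z = at-z y≡z
    ... | inj₂ (ch , pc , ch≼y) with ≡-decᵐ _≟ᶠ_ (lb z) (just ch) | y ≟ᶠ ch
    ...   | yes e       | _       = in-last ch e ch≼y
    ...   | no not-last | yes y≡ch = at-child ch (pc , not-last) y≡ch
    ...   | no not-last | no y≢ch  = in-child ch (pc , not-last) ch≼y y≢ch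

    -- In a label (S , Q , false), standing for S ∪ {v_{S,Q}}, the component Q is arbitrary
    -- whenever no vertex v_{S,Q} of that level lies in the image.
    place : ∀ y → Region y → BV (3 + K) × BI (3 + K)
    place y (at-z _)           = root (3 + K) , (S-root , S-root , false) , label (2 + K) 0 , false
    place y (in-last w _ _)    = inj₁ (copy S-last (liftψ (ψ↓ w) y)) ,
                                 (S-last , liftσ (σ↓ w) y , true) , label (2 + K) 0 , false
    place y (at-child ch _ _)  = inj₁ (childVertex ch) , childSet ch , label (2 + K) 0 , false
    place y (in-child ch _ _ _) = copy (childSet ch) (ψ⇈ ch y) , childSet ch , σ⇈ ch y , true

    child≢z : ∀ {ch} → IsParent z ch → ch ≢ z
    child≢z pc refl = child⋠parent pc ≼-refl

    last-born-unique : ∀ {w w′} → lb z ≡ just w → lb z ≡ just w′ → w ≡ w′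
    last-born-unique e e′ = just-injective (trans (sym e) e′)

    last-born⋡non-last : ∀ {w ch y} → lb z ≡ just w → NonLast ch → w ≼ y → ch ≼ y → ⊥
    last-born⋡non-last {w} e (pc , not-last) w≼y ch≼y =
      not-last (trans e (cong just (child-≼-unique (lb-child z w e) pc w≼y ch≼y)))

    place-irrelevant : ∀ {y} (r r′ : Region y) → place y r ≡ place y r′
    place-irrelevant (at-z _) (at-z _) = refl
    place-irrelevant (at-z refl) (in-last w e w≼z) = ⊥-elim (child⋠parent (lb-child z w e) w≼z)
    place-irrelevant (at-z refl) (at-child _ (pc , _) e) = ⊥-elim (child≢z pc (sym e))
    place-irrelevant (at-z refl) (in-child _ (pc , _) ch≼z _) = ⊥-elim (child⋠parent pc ch≼z)
    place-irrelevant (in-last w e w≼z) (at-z refl) = ⊥-elim (child⋠parent (lb-child z w e) w≼z)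
    place-irrelevant (in-last _ e _) (in-last _ e′ _) with last-born-unique e e′
    ... | refl = refl
    place-irrelevant (in-last _ e w≼y) (at-child _ nl refl) = ⊥-elim (last-born⋡non-last e nl w≼y ≼-refl)
    place-irrelevant (in-last _ e w≼y) (in-child _ nl ch≼y _) = ⊥-elim (last-born⋡non-last e nl w≼y ch≼y)
    place-irrelevant (at-child _ (pc , _) e) (at-z e′) = ⊥-elim (child≢z pc (trans (sym e) e′))
    place-irrelevant (at-child _ nl refl) (in-last _ e w≼y) = ⊥-elim (last-born⋡non-last e nl w≼y ≼-refl)
    place-irrelevant (at-child _ _ refl) (at-child _ _ refl) = refl
    place-irrelevant (at-child _ (pc , _) refl) (in-child _ (pc′ , _) ch≼y y≢ch) =
      ⊥-elim (y≢ch (child-≼-unique pc pc′ ≼-refl ch≼y))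
    place-irrelevant (in-child _ (pc , _) ch≼z _) (at-z refl) = ⊥-elim (child⋠parent pc ch≼z)
    place-irrelevant (in-child _ nl ch≼y _) (in-last _ e w≼y) = ⊥-elim (last-born⋡non-last e nl w≼y ch≼y)
    place-irrelevant (in-child _ (pc , _) ch≼y y≢ch) (at-child _ (pc′ , _) refl) =
      ⊥-elim (y≢ch (child-≼-unique pc′ pc ≼-refl ch≼y))
    place-irrelevant (in-child _ (pc , _) ch≼y _) (in-child _ (pc′ , _) ch′≼y _)
      with child-≼-unique pc pc′ ch≼y ch′≼y
    ... | refl = refl

    placeψ : ∀ y → Region y → BV (3 + K)
    placeψ y r = proj₁ (place y r)

    placeσ : ∀ y → Region y → BI (3 + K)
    placeσ y r = proj₂ (place y r)

    last-isEmbedding : ∀ {w} → lb z ≡ just w → IsEmbedding w (liftψ (ψ↓ w)) (liftσ (σ↓ w))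
    last-isEmbedding {w} e = lift (sub-isEmbedding (lb-child z w e))

    child-isEmbedding : ∀ {ch} → NonLast ch → IsEmbedding ch (ψ⇈ ch) (σ⇈ ch)
    child-isEmbedding (pc , _) = lift (lift (sub-isEmbedding pc))

    open IsEmbedding

    place-injective : ∀ {x y} (rx : Region x) (ry : Region y) → placeψ x rx ≡ placeψ y ry → x ≡ y
    place-injective (at-z e) (at-z e′) _ = trans e (sym e′)
    place-injective (in-last _ e w≼x) (in-last _ e′ w≼y) eq with last-born-unique e e′
    ... | refl = ψ-injective (last-isEmbedding e) w≼x w≼y (proj₂ (copy-injective (inj₁-injective eq)))
    place-injective (at-child _ nl refl) (at-child _ nl′ refl) eq =
      childLabel-injective nl nl′ (inj₂-injective (inj₂-injective (inj₁-injective eq)))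
    place-injective (in-child _ nl ch≼x _) (in-child _ nl′ ch′≼y _) eq
      with childSet-injective nl nl′ (proj₁ (copy-injective eq))
    ... | refl = ψ-injective (child-isEmbedding nl) ch≼x ch′≼y (proj₂ (copy-injective eq))
    place-injective (at-z _)           (in-last _ _ _)    ()
    place-injective (at-z _)           (at-child _ _ _)   ()
    place-injective (at-z _)           (in-child _ _ _ _) ()
    place-injective (in-last _ _ _)    (at-z _)           ()
    place-injective (in-last _ _ _)    (at-child _ _ _)   ()
    place-injective (in-last _ _ _)    (in-child _ _ _ _) ()
    place-injective (at-child _ _ _)   (at-z _)           ()
    place-injective (at-child _ _ _)   (in-last _ _ _)    ()
    place-injective (at-child _ _ _)   (in-child _ _ _ _) ()
    place-injective (in-child _ _ _ _) (at-z _)           ()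
    place-injective (in-child _ _ _ _) (in-last _ _ _)    ()
    place-injective (in-child _ _ _ _) (at-child _ _ _)   ()

    child-arc⇔ : ∀ {w ch y} → lb z ≡ just w → w ≼ y → NonLast ch →
                 y ∈ c ch ⇔ BAdj (2 + K) (copy S-last (liftψ (ψ↓ w) y)) (childVertex ch)
    child-arc⇔ {w} {ch} {y} e w≼y nl with childLabel-spec nl
    ... | inj₁ (c≡[] , l≡) rewrite l≡ =
      mk⇔ (λ y∈ → ⊥-elim (∈-≡[] c≡[] y∈)) (λ (eq , _) → ⊥-elim (S-last≢S-isolated eq))
    ... | inj₂ (_ , e′ , b , w≼b , interval , l≡) rewrite l≡ with last-born-unique e e′
    ...   | refl = mk⇔
      (λ y∈ → refl , Equivalence.to (σ-branch W w≼b w≼y) (proj₂ (Equivalence.to (interval y) y∈)))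
      (λ (_ , m) → Equivalence.from (interval y) (w≼y , Equivalence.from (σ-branch W w≼b w≼y) m))
      where
      W : IsEmbedding w (ψ↓ w) (σ↓ w)
      W = sub-isEmbedding (lb-child z w e)

    arc⇒BAdj : ∀ {x y} (rx : Region x) (ry : Region y) → z ≼ x → z ≼ y → y ∈ c x →
               BAdj (3 + K) (placeψ x rx) (placeψ y ry)
    arc⇒BAdj {x} {y} rx ry z≼x z≼y y∈ with arc-below z≼x z≼y y∈
    ... | inj₁ (pc , not-last , w , e , w≼y)
      rewrite place-irrelevant rx (at-child x (pc , not-last) refl) | place-irrelevant ry (in-last w e w≼y) =
      Equivalence.to (child-arc⇔ e w≼y (pc , not-last)) y∈
    ... | inj₂ (ch , pc , ch≼x , ch≼y , ch≢x , ch≢y) with ≡-decᵐ _≟ᶠ_ (lb z) (just ch)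
    ...   | yes e
      rewrite place-irrelevant rx (in-last ch e ch≼x) | place-irrelevant ry (in-last ch e ch≼y) =
      refl , Equivalence.to (ψ-adjacent (last-isEmbedding e) ch≼x ch≼y) (inj₁ y∈)
    ...   | no not-last
      rewrite place-irrelevant rx (in-child ch (pc , not-last) ch≼x (λ e → ch≢x (sym e)))
            | place-irrelevant ry (in-child ch (pc , not-last) ch≼y (λ e → ch≢y (sym e))) =
      refl , Equivalence.to (ψ-adjacent (child-isEmbedding (pc , not-last)) ch≼x ch≼y) (inj₁ y∈)

    BAdj⇒UAdj : ∀ {x y} (rx : Region x) (ry : Region y) →
                BAdj (3 + K) (placeψ x rx) (placeψ y ry) → UAdj x y
    BAdj⇒UAdj (at-z _) ry a = ⊥-elim (BAdj-root (3 + K) (placeψ _ ry) a)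
    BAdj⇒UAdj rx (at-z refl) a =
      ⊥-elim (BAdj-root (3 + K) (placeψ _ rx) (BAdj-sym (3 + K) (placeψ _ rx) (root (3 + K)) a))
    BAdj⇒UAdj (in-last _ e w≼x) (in-last _ e′ w≼y) (_ , a) with last-born-unique e e′
    ... | refl = Equivalence.from (ψ-adjacent (last-isEmbedding e) w≼x w≼y) a
    BAdj⇒UAdj (in-last _ e w≼x) (at-child _ nl refl) a = inj₂ (Equivalence.from (child-arc⇔ e w≼x nl) a)
    BAdj⇒UAdj (at-child _ nl refl) (in-last _ e w≼y) a = inj₁ (Equivalence.from (child-arc⇔ e w≼y nl) a)
    BAdj⇒UAdj (in-child _ nl ch≼x _) (in-child _ nl′ ch′≼y _) (e , a)
      with childSet-injective nl nl′ e
    ... | refl = Equivalence.from (ψ-adjacent (child-isEmbedding nl) ch≼x ch′≼y) a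
    BAdj⇒UAdj (in-last _ _ _)    (in-child _ _ _ _) ()
    BAdj⇒UAdj (at-child _ _ _)   (at-child _ _ _)   ()
    BAdj⇒UAdj (at-child _ _ _)   (in-child _ _ _ _) ()
    BAdj⇒UAdj (in-child _ _ _ _) (in-last _ _ _)    ()
    BAdj⇒UAdj (in-child _ _ _ _) (at-child _ _ _)   ()

    place-adjacent : ∀ {x y} (rx : Region x) (ry : Region y) → z ≼ x → z ≼ y →
                     UAdj x y ⇔ BAdj (3 + K) (placeψ x rx) (placeψ y ry)
    place-adjacent rx ry z≼x z≼y = mk⇔ to (BAdj⇒UAdj rx ry)
      where
      to : UAdj _ _ → BAdj (3 + K) (placeψ _ rx) (placeψ _ ry)
      to (inj₁ y∈) = arc⇒BAdj rx ry z≼x z≼y y∈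
      to (inj₂ x∈) = BAdj-sym (3 + K) (placeψ _ ry) (placeψ _ rx) (arc⇒BAdj ry rx z≼y z≼x x∈)

    Bmem⇒≼ : ∀ {x y} (rx : Region x) (ry : Region y) → z ≼ x →
             Bmem (3 + K) (placeσ x rx) (placeψ y ry) → y ≼ x
    Bmem⇒≼ _ (at-z refl) z≼x _ = z≼x
    Bmem⇒≼ (at-z refl) (at-child _ nl refl) _ m = ⊥-elim (childLabel≢root nl (cong proj₁ m))
    Bmem⇒≼ (in-last _ e w≼x) (in-last _ e′ w≼y) _ (_ , m) with last-born-unique e e′
    ... | refl = Equivalence.from (σ-branch (last-isEmbedding e) w≼x w≼y) m
    Bmem⇒≼ (at-child _ nl refl) (at-child _ nl′ refl) _ m with childLabel-injective nl′ nl m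
    ... | refl = ≼-refl
    Bmem⇒≼ (in-child _ nl ch≼x _) (at-child _ nl′ refl) _ m with childLabel-injective nl′ nl m
    ... | refl = ch≼x
    Bmem⇒≼ (in-child _ nl ch≼x _) (in-child _ nl′ ch′≼y _) _ (e , m)
      with childSet-injective nl′ nl e
    ... | refl = Equivalence.from (σ-branch (child-isEmbedding nl) ch≼x ch′≼y) m
    Bmem⇒≼ (at-z _)           (in-last _ _ _)    _ ()
    Bmem⇒≼ (at-z _)           (in-child _ _ _ _) _ ()
    Bmem⇒≼ (in-last _ _ _)    (at-child _ _ _)   _ ()
    Bmem⇒≼ (in-last _ _ _)    (in-child _ _ _ _) _ ()
    Bmem⇒≼ (at-child _ _ _)   (in-last _ _ _)    _ ()
    Bmem⇒≼ (at-child _ _ _)   (in-child _ _ _ _) _ ()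
    Bmem⇒≼ (in-child _ _ _ _) (in-last _ _ _)    _ ()

    ≼⇒Bmem : ∀ {x y} (rx : Region x) (ry : Region y) → y ≼ x →
             Bmem (3 + K) (placeσ x rx) (placeψ y ry)
    ≼⇒Bmem rx (at-z refl) _ = Bmem-root (3 + K) (placeσ _ rx)
    ≼⇒Bmem (at-z refl) (in-last _ e w≼y) y≼z = ⊥-elim (child⋠parent (lb-child z _ e) (≼-trans w≼y y≼z))
    ≼⇒Bmem (at-z refl) (at-child _ (pc , _) refl) y≼z = ⊥-elim (child⋠parent pc y≼z)
    ≼⇒Bmem (at-z refl) (in-child _ (pc , _) ch≼y _) y≼z = ⊥-elim (child⋠parent pc (≼-trans ch≼y y≼z))
    ≼⇒Bmem (in-last _ e w≼x) (in-last _ e′ w≼y) y≼x with last-born-unique e e′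
    ... | refl = refl , Equivalence.to (σ-branch (last-isEmbedding e) w≼x w≼y) y≼x
    ≼⇒Bmem (in-last _ e w≼x) (at-child _ nl refl) y≼x = ⊥-elim (last-born⋡non-last e nl w≼x y≼x)
    ≼⇒Bmem (in-last _ e w≼x) (in-child _ nl ch≼y _) y≼x =
      ⊥-elim (last-born⋡non-last e nl w≼x (≼-trans ch≼y y≼x))
    ≼⇒Bmem (at-child _ nl refl) (in-last _ e w≼y) y≼x =
      ⊥-elim (last-born⋡non-last e nl (≼-trans w≼y y≼x) ≼-refl)
    ≼⇒Bmem (at-child _ (pc , _) refl) (at-child _ (pc′ , _) refl) y≼x
      with children-≼⇒≡ pc′ pc y≼x
    ... | refl = refl
    ≼⇒Bmem (at-child _ (pc , _) refl) (in-child _ (pc′ , _) ch′≼y y≢ch′) y≼x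
      with children-≼⇒≡ pc′ pc (≼-trans ch′≼y y≼x)
    ... | refl = ⊥-elim (y≢ch′ (≼-antisym y≼x ch′≼y))
    ≼⇒Bmem (in-child _ nl ch≼x _) (in-last _ e w≼y) y≼x =
      ⊥-elim (last-born⋡non-last e nl (≼-trans w≼y y≼x) ch≼x)
    ≼⇒Bmem (in-child _ (pc , _) ch≼x _) (at-child _ (pc′ , _) refl) y≼x
      with child-≼-unique pc′ pc y≼x ch≼x
    ... | refl = refl
    ≼⇒Bmem (in-child _ nl@(pc , _) ch≼x _) (in-child _ (pc′ , _) ch′≼y _) y≼x
      with child-≼-unique pc′ pc (≼-trans ch′≼y y≼x) ch≼x
    ... | refl = refl , Equivalence.to (σ-branch (child-isEmbedding nl) ch≼x ch′≼y) y≼x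

    embed : Vertex → BV (3 + K) × BI (3 + K)
    embed y with z ≼? y
    ... | yes z≼y = place y (region z≼y)
    ... | no _    = root (3 + K) , label (3 + K) 0

    embed≡place : ∀ {y} (z≼y : z ≼ y) → embed y ≡ place y (region z≼y)
    embed≡place {y} z≼y with z ≼? y
    ... | yes z≼y′ = place-irrelevant (region z≼y′) (region z≼y)
    ... | no z⋠y   = ⊥-elim (z⋠y z≼y)

    ψ : Vertex → BV (3 + K)
    ψ y = proj₁ (embed y)

    σ : Vertex → BI (3 + K)
    σ y = proj₂ (embed y)

    isEmbedding : IsEmbedding z ψ σ
    isEmbedding = record
      { ψ-root      = cong proj₁ (embed≡place ≼-refl)
      ; ψ-injective = λ {x} {y} z≼x z≼y e →
          place-injective (region z≼x) (region z≼y)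
            (trans (cong proj₁ (sym (embed≡place z≼x))) (trans e (cong proj₁ (embed≡place z≼y))))
      ; ψ-adjacent  = λ {x} {y} z≼x z≼y → 
          subst₂ (λ a b → UAdj x y ⇔ BAdj (3 + K) a b)
                 (cong proj₁ (sym (embed≡place z≼x))) (cong proj₁ (sym (embed≡place z≼y)))
                 (place-adjacent (region z≼x) (region z≼y) z≼x z≼y)
      ; σ-branch    = λ {x} {y} z≼x z≼y →
          subst₂ (λ a b → y ≼ x ⇔ Bmem (3 + K) a b)
                 (cong proj₂ (sym (embed≡place z≼x))) (cong proj₁ (sym (embed≡place z≼y)))
                 (mk⇔ (≼⇒Bmem (region z≼x) (region z≼y)) (Bmem⇒≼ (region z≼x) (region z≼y) z≼x))
      }

    embedding : Embedding z (3 + K)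
    embedding = record { ψ = ψ ; σ = σ ; isEmbedding = isEmbedding }

  level : ℕ → ℕ
  level zero    = 3 + (m + 2)
  level (suc n) = 3 + level n

  m+2≤level : ∀ n → m + 2 ≤ level n
  m+2≤level zero    = m≤n+m (m + 2) 3
  m+2≤level (suc n) = ≤-trans (m+2≤level n) (m≤n+m (level n) 3)

  embedding : ∀ n z → m ≤ n + toℕ z → Embedding z (level n)
  embedding zero z m≤z = Step.embedding z (m + 2) ≤-refl beyond-last
    where
    beyond-last : ∀ z′ → toℕ z < toℕ z′ → Embedding z′ (m + 2)
    beyond-last z′ z<z′ =
      ⊥-elim (<-irrefl refl (<-≤-trans z<z′ (≤-trans (≤-pred (toℕ<n z′)) m≤z)))
  embedding (suc n) z m≤ = Step.embedding z (level n) (m+2≤level n) below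
    where
    below : ∀ z′ → toℕ z < toℕ z′ → Embedding z′ (level n)
    below z′ z<z′ =
      embedding n z′ (≤-trans m≤ (≤-trans (≤-reflexive (sym (+-suc n (toℕ z)))) (+-monoʳ-≤ n z<z′)))

derived⇒burling : ∀ H → IsDerivedGraph H → IsBurlingGraph H
derived⇒burling H (T , iso) =
  level m , IsoToInduced-∘ {H = H} {R = UAdj} {R′ = BAdj (level m)}
                           iso ψ (ψ-injective (root≼ _) (root≼ _))
                           (λ a b → ψ-adjacent (root≼ a) (root≼ b))
  where
  open BurlingTree T
  open Ancestry T
  open SubtreeEmbedding T
  open Embedding (embedding m zero (m≤m+n m 0))
  open IsEmbedding isEmbedding

theorem4p9 : (H : FinGraph) → IsBurlingGraph H ⇔ IsDerivedGraph H
theorem4p9 H = mk⇔ (burling⇒derived H) (derived⇒burling H)
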